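{- The Wang shift $\Omega_\mathcal{Z}$ is self-similar, satisfying $\overline{\phi(\Omega_\mathcal{Z})}^\sigma=\Omega_\mathcal{Z}$, where $\phi$ is the 2-dimensional morphism on $\mathcal{H}=\{0,\dots,15\}$ described in the context.
   Context: Wang tiles are 4-tuples of colors read as (east, north, west, south). $\mathcal{Z}=\{z_0,\dots,z_{15}\}$ with $z_0=(D,O,J,O)$, $z_1=(D,O,H,L)$, $z_2=(J,M,D,P)$, $z_3=(D,M,D,K)$, $z_4=(H,P,J,P)$, $z_5=(H,P,H,N)$, $z_6=(H,K,D,P)$, $z_7=(B,O,I,O)$, $z_8=(I,L,E,O)$, $z_9=(I,L,C,L)$, $z_{10}=(A,L,I,O)$, $z_{11}=(E,P,I,P)$, $z_{12}=(I,P,I,K)$, $z_{13}=(I,K,B,M)$, $z_{14}=(I,K,A,K)$, $z_{15}=(C,N,I,P)$. $\Omega_\mathcal{Z}$ is the set of $f:\mathbb{Z}^2\to\mathcal{H}$ such that for all ${\boldsymbol{n}}$ the east label of $z_{f({\boldsymbol{n}})}$ equals the west label of $z_{f({\boldsymbol{n}}+e_1)}$ and the north label of $z_{f({\boldsymbol{n}})}$ equals the south label of $z_{f({\boldsymbol{n}}+e_2)}$; $\sigma$ is the shift action $(\sigma^{\boldsymbol{k}}f)({\boldsymbol{n}})=f({\boldsymbol{n}}+{\boldsymbol{k}})$. A 2-dimensional word of shape $(m,n)$ is a map on $\{0,\dots,m-1\}\times\{0,\dots,n-1\}$, position $(0,0)$ being the lower-left corner. $\phi$ assigns: $\phi(0)=14$,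 $\phi(1)=13$ (shape $(1,1)$); $\phi(2)$: $(0,0)\mapsto12,(1,0)\mapsto10$; $\phi(3)$: $(0,0)\mapsto11,(1,0)\mapsto8$; $\phi(4)$: $(0,0)\mapsto14,(1,0)\mapsto7$; $\phi(5)$: $(0,0)\mapsto13,(1,0)\mapsto7$; $\phi(6)$: $(0,0)\mapsto12,(1,0)\mapsto7$ (shape $(2,1)$); $\phi(7)$: $(0,0)\mapsto12,(0,1)\mapsto6$; $\phi(8)$: $(0,0)\mapsto14,(0,1)\mapsto3$; $\phi(9)$: $(0,0)\mapsto13,(0,1)\mapsto3$; $\phi(10)$: $(0,0)\mapsto12,(0,1)\mapsto2$ (shape $(1,2)$); $\phi(11)$: $(0,0)\mapsto12,(1,0)\mapsto10,(0,1)\mapsto6,(1,1)\mapsto1$; $\phi(12)$: $(0,0)\mapsto11,(1,0)\mapsto8,(0,1)\mapsto6,(1,1)\mapsto1$; $\phi(13)$: $(0,0)\mapsto15,(1,0)\mapsto9,(0,1)\mapsto5,(1,1)\mapsto1$; $\phi(14)$: $(0,0)\mapsto11,(1,0)\mapsto8,(0,1)\mapsto4,(1,1)\mapsto1$; $\phi(15)$: $(0,0)\mapsto12,(1,0)\mapsto7,(0,1)\mapsto2,(1,1)\mapsto0$ (shape $(2,2)$). For a configuration $y\in\Omega_\mathcal{Z}$, $\phi(y)\in\mathcal{H}^{\mathbb{Z}^2}$ is obtained by concatenating the blocks $\phi(y_{\boldsymbol{n}})$ according to the positions ${\boldsymbol{n}}$, with $\phi(y_{(0,0)})$ having lower-left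 corner at the origin. $\overline{\phi(\Omega_\mathcal{Z})}^\sigma=\{\sigma^{\boldsymbol{k}}\phi(y):{\boldsymbol{k}}\in\mathbb{Z}^2,y\in\Omega_\mathcal{Z}\}$. Self-similar means $X=\overline{\omega(X)}^\sigma$ for an expansive 2-dimensional morphism $\omega$ (width and height of $\omega^k(a)$ tend to $\infty$ for all letters $a$). -}

module Defs where

open import Data.Nat using (ℕ; zero; suc; _+_; _≤_)
open import Data.Integer as ℤ using (ℤ; +_; -[1+_]) renaming (_+_ to _+ℤ_; _-_ to _-ℤ_; -_ to -ℤ_)
open import Data.Fin using (Fin; zero; suc; #_)
open import Data.Vec using (Vec; []; _∷_; lookup)
open import Data.List using (List; map; allFin)
open import Data.Nat.ListAction using (sum)
open import Data.Product using (_×_; _,_; proj₁; proj₂; Σ; ∃)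
open import Relation.Binary.PropositionalEquality using (_≡_)

data Color : Set where
  A B C D E H I J K L M N O P : Color

record Tile : Set where
  constructor tile
  field
    east north west south : Color
open Tile public

ℋ : Set
ℋ = Fin 16

𝒵 : Vec Tile 16
𝒵 = tile D O J O ∷ tile D O H L ∷ tile J M D P ∷ tile D M D K
  ∷ tile H P J P ∷ tile H P H N ∷ tile H K D P ∷ tile B O I O
  ∷ tile I L E O ∷ tile I L C L ∷ tile A L I O ∷ tile E P I P
  ∷ tile I P I K ∷ tile I K B M ∷ tile I K A K ∷ tile C N I P ∷ []

z : ℋ → Tile
z a = lookup 𝒵 a

Pos : Set
Pos = ℤ × ℤ

Config : Set
Config = Pos → ℋ

e₁ e₂ : Pos
e₁ = (+ 1 , + 0)
e₂ = (+ 0 , + 1)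

_⊕_ : Pos → Pos → Pos
(a , b) ⊕ (c , d) = (a +ℤ c , b +ℤ d)

σ : Pos → Config → Config
σ k f n = f (n ⊕ k)

Ω𝒵 : Config → Set
Ω𝒵 f = ∀ (n : Pos) →
  (east (z (f n)) ≡ west (z (f (n ⊕ e₁)))) ×
  (north (z (f n)) ≡ south (z (f (n ⊕ e₂))))

-- Finite 2-dimensional words (nonempty), (0,0) = lower-left corner

record Word : Set where
  constructor word
  field
    w-1 h-1 : ℕ
    cell : Fin (suc w-1) → Fin (suc h-1) → ℋ
  width height : ℕ
  width = suc w-1
  height = suc h-1
open Word public

w11 : ℋ → Word
w11 a = word 0 0 (λ _ _ → a)

w21 : ℋ → ℋ → Word
w21 a b = word 1 0 f
  where
  f : Fin 2 → Fin 1 → ℋ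
  f zero _ = a
  f (suc _) _ = b

w12 : ℋ → ℋ → Word
w12 a b = word 0 1 f
  where
  f : Fin 1 → Fin 2 → ℋ
  f _ zero = a
  f _ (suc _) = b

w22 : ℋ → ℋ → ℋ → ℋ → Word
w22 a b c d = word 1 1 f
  where
  f : Fin 2 → Fin 2 → ℋ
  f zero zero = a
  f (suc _) zero = b
  f zero (suc _) = c
  f (suc _) (suc _) = d

φtable : Vec Word 16
φtable =
    w11 (# 14)
  ∷ w11 (# 13)
  ∷ w21 (# 12) (# 10)
  ∷ w21 (# 11) (# 8)
  ∷ w21 (# 14) (# 7)
  ∷ w21 (# 13) (# 7)
  ∷ w21 (# 12) (# 7)
  ∷ w12 (# 12) (# 6)
  ∷ w12 (# 14) (# 3)
  ∷ w12 (# 13) (# 3)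
  ∷ w12 (# 12) (# 2)
  ∷ w22 (# 12) (# 10) (# 6) (# 1)
  ∷ w22 (# 11) (# 8) (# 6) (# 1)
  ∷ w22 (# 15) (# 9) (# 5) (# 1)
  ∷ w22 (# 11) (# 8) (# 4) (# 1)
  ∷ w22 (# 12) (# 7) (# 2) (# 0)
  ∷ []

φ : ℋ → Word
φ a = lookup φtable a

-- Block φ(y_n) is placed with lower-left corner at (X n₁ , Y n₂), where
-- X is the cumulative sum of the block widths along row 0 (X 0 = 0) and
-- Y the cumulative sum of the block heights along column 0 (Y 0 = 0).

prefixSum : (ℕ → ℕ) → ℕ → ℕ
prefixSum f zero = 0
prefixSum f (suc n) = prefixSum f n + f n

offset : (ℤ → ℕ) → ℤ → ℤ
offset w (+ n) = + prefixSum (λ i → w (+ i)) n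
offset w (-[1+ n ]) = -ℤ (+ prefixSum (λ i → w (-[1+ i ])) (suc n))

colWidth : Config → ℤ → ℕ
colWidth y i = width (φ (y (i , + 0)))

rowHeight : Config → ℤ → ℕ
rowHeight y j = height (φ (y (+ 0 , j)))

toℤ : ∀ {n} → Fin n → ℤ
toℤ i = + Data.Fin.toℕ i

IsφImage : Config → Config → Set
IsφImage y x = ∀ (n : Pos) (i : Fin (width (φ (y n)))) (j : Fin (height (φ (y n)))) →
  x ( offset (colWidth y) (proj₁ n) +ℤ toℤ i
    , offset (rowHeight y) (proj₂ n) +ℤ toℤ j )
  ≡ cell (φ (y n)) i j

neg : Pos → Pos
neg (a , b) = (ℤ.- a , ℤ.- b)

-- x ∈ \overline{φ(Ω_𝒵)}^σ  :⇔  x = σ^k φ(y) for some k ∈ ℤ² and y ∈ Ω_𝒵.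
-- x = σ^k φ(y)  ⇔  φ(y) = σ^{-k} x.
InShiftClosureφΩ : Config → Set
InShiftClosureφΩ x = Σ Pos λ k → Σ Config λ y → Ω𝒵 y × IsφImage y (σ (neg k) x)

-- Expansiveness: width and height of φ^k(a).
-- φ^(k+1)(a) = φ^k(φ(a)); its width is the sum of the widths of φ^k(b)
-- over the letters b of the bottom row of φ(a), its height the sum of
-- the heights of φ^k(b) over the letters b of the left column of φ(a).

iterWidth : ℕ → ℋ → ℕ
iterWidth zero a = 1
iterWidth (suc k) a = sum (map (λ i → iterWidth k (cell (φ a) i zero)) (allFin (width (φ a))))

iterHeight : ℕ → ℋ → ℕ
iterHeight zero a = 1
iterHeight (suc k) a = sum (map (λ j → iterHeight k (cell (φ a) zero j)) (allFin (height (φ a))))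

Expansive : Set
Expansive = ∀ (a : ℋ) (N : ℕ) → ∃ λ K → ∀ k → K ≤ k → (N ≤ iterWidth k a) × (N ≤ iterHeight k a)

module Submission where

-- Every letter t is sent by φ to a block of width and height 1 or 2, and these blocks fit together
-- like the tiles themselves: two tiles are adjacent in a valid tiling exactly when their blocks have the
-- same height (width) and fit along the shared edge, and every block is internally valid.  Hence φ maps
-- Ω_𝒵 into Ω_𝒵, and so does every shift of its images.  Conversely, in a valid tiling x each tile is
-- marked as lying in the first or the second column (row) of a block; the mark is constant along
-- columns (rows) and second columns (rows) are isolated.  Cutting ℤ² accordingly into blocks, the
-- block at each corner is φ(t) for a letter t whose shape is announced by the marks, and these letters
-- form a valid tiling y with x = σᵏ φ(y).  All facts about the sixteen tiles are decided by exhaustive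
-- evaluation, over single tiles, pairs, or all valid 3 × 3 and 5 × 3 patches.  Finally, every corner
-- letter of a block has a 2 × 2 image, so the width and height of φᵏ(a) double every two steps.

open import Defs
open import Algebra.Bundles using (AbelianGroup)
open import Data.Bool using (Bool; true; false; T; _∧_; if_then_else_)
import Data.Bool.Properties as Boolₚ
open import Data.Fin as Fin using (Fin; zero; suc; toℕ; fromℕ<; #_; inject₁)
open import Data.Fin.Properties using (all?; any?; toℕ-fromℕ<; toℕ-inject₁; toℕ<n)
open import Data.Integer using (ℤ; +_; -[1+_]; 0ℤ; 1ℤ; -1ℤ; _+_; _-_; -_)
import Data.Integer as ℤ
import Data.Integer.Properties as ℤₚ
open import Algebra.Properties.Group (AbelianGroup.group ℤₚ.+-0-abelianGroup) using (∙-cancelʳ)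
open import Data.Integer.Tactic.RingSolver using (solve-∀)
open import Data.List using (List; map; concatMap; filterᵇ; allFin)
open import Data.List.Membership.Propositional using (_∈_)
open import Data.List.Membership.Propositional.Properties using (∈-map⁺; ∈-concatMap⁺; ∈-filter⁺; ∈-allFin)
import Data.List.Relation.Unary.All as All
import Data.List.Relation.Unary.Any as Any
open import Data.Nat as ℕ using (ℕ; zero; suc; _<_; _≤_; _∸_; z<s; z≤n; s≤s)
open import Data.Nat.ListAction using (sum)
import Data.Nat.Properties as ℕₚ
open import Data.Product using (_×_; _,_; proj₁; proj₂; Σ; ∃)
open import Data.Unit using (⊤; tt)
open import Data.Vec as Vec using (Vec; []; _∷_; lookup; head; [_])
open import Data.Vec.Relation.Binary.Pointwise.Inductive as Pointwise using (Pointwise; []; _∷_)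
open import Function.Bundles using (_⇔_; mk⇔; Equivalence)
open import Relation.Binary.Definitions using (DecidableEquality)
open import Relation.Binary.PropositionalEquality
  using (_≡_; refl; sym; trans; cong; cong₂; subst; subst₂; module ≡-Reasoning)
open import Relation.Nullary.Decidable
  using (Dec; yes; no; True; isYes; map′; toWitness; fromWitness; from-yes; T?; _×-dec_; _→-dec_)
open import Relation.Unary using (Decidable)

colourIndex : Color → ℕ
colourIndex A = 0
colourIndex B = 1
colourIndex C = 2
colourIndex D = 3
colourIndex E = 4
colourIndex H = 5
colourIndex I = 6
colourIndex J = 7
colourIndex K = 8
colourIndex L = 9
colourIndex M = 10
colourIndex N = 11
colourIndex O = 12
colourIndex P = 13

colourOfIndex : ℕ → Color
colourOfIndex 0 = A
colourOfIndex 1 = B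
colourOfIndex 2 = C
colourOfIndex 3 = D
colourOfIndex 4 = E
colourOfIndex 5 = H
colourOfIndex 6 = I
colourOfIndex 7 = J
colourOfIndex 8 = K
colourOfIndex 9 = L
colourOfIndex 10 = M
colourOfIndex 11 = N
colourOfIndex 12 = O
colourOfIndex _ = P

colourOfIndex-colourIndex : ∀ c → colourOfIndex (colourIndex c) ≡ c
colourOfIndex-colourIndex A = refl
colourOfIndex-colourIndex B = refl
colourOfIndex-colourIndex C = refl
colourOfIndex-colourIndex D = refl
colourOfIndex-colourIndex E = refl
colourOfIndex-colourIndex H = refl
colourOfIndex-colourIndex I = refl
colourOfIndex-colourIndex J = refl
colourOfIndex-colourIndex K = refl
colourOfIndex-colourIndex L = refl
colourOfIndex-colourIndex M = refl
colourOfIndex-colourIndex N = refl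
colourOfIndex-colourIndex O = refl
colourOfIndex-colourIndex P = refl

-- Via ℕ, whose equality test is builtin: the exhaustive checks below compare colours very often.
_≟ᶜ_ : DecidableEquality Color
c ≟ᶜ d = map′ injective (cong colourIndex) (colourIndex c ℕ.≟ colourIndex d)
  where
  injective : colourIndex c ≡ colourIndex d → c ≡ d
  injective eq = trans (sym (colourOfIndex-colourIndex c))
    (trans (cong colourOfIndex eq) (colourOfIndex-colourIndex d))

HFit VFit : ℋ → ℋ → Set
HFit a b = east (z a) ≡ west (z b)
VFit a b = north (z a) ≡ south (z b)

HFit? : ∀ a b → Dec (HFit a b)
HFit? a b = east (z a) ≟ᶜ west (z b)

VFit? : ∀ a b → Dec (VFit a b)
VFit? a b = north (z a) ≟ᶜ south (z b)

⊕-swap : ∀ a b c → (a ⊕ b) ⊕ c ≡ (a ⊕ c) ⊕ b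
⊕-swap (a₁ , a₂) (b₁ , b₂) (c₁ , c₂) = cong₂ _,_ (swap a₁ b₁ c₁) (swap a₂ b₂ c₂)
  where
  swap : ∀ a b c → (a + b) + c ≡ (a + c) + b
  swap = solve-∀

⊕-neg-cancel : ∀ n k → (n ⊕ k) ⊕ neg k ≡ n
⊕-neg-cancel (n₁ , n₂) (k₁ , k₂) = cong₂ _,_ (cancel n₁ k₁) (cancel n₂ k₂)
  where
  cancel : ∀ a b → (a + b) + - b ≡ a
  cancel = solve-∀

⊕-e₁ : ∀ p q → (p , q) ⊕ e₁ ≡ (ℤ.suc p , q)
⊕-e₁ p q = cong₂ _,_ (ℤₚ.+-comm p 1ℤ) (ℤₚ.+-identityʳ q)

⊕-e₂ : ∀ p q → (p , q) ⊕ e₂ ≡ (p , ℤ.suc q)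
⊕-e₂ p q = cong₂ _,_ (ℤₚ.+-identityʳ p) (ℤₚ.+-comm q 1ℤ)

Ω𝒵-σ : ∀ k x → Ω𝒵 x → Ω𝒵 (σ k x)
Ω𝒵-σ k x valid n =
  trans (proj₁ (valid (n ⊕ k))) (cong (λ m → west (z (x m))) (⊕-swap n k e₁)) ,
  trans (proj₂ (valid (n ⊕ k))) (cong (λ m → south (z (x m))) (⊕-swap n k e₂))

Ω𝒵-resp : ∀ x x' → (∀ n → x n ≡ x' n) → Ω𝒵 x → Ω𝒵 x'
Ω𝒵-resp x x' eq valid n =
  subst₂ HFit (eq n) (eq (n ⊕ e₁)) (proj₁ (valid n)) ,
  subst₂ VFit (eq n) (eq (n ⊕ e₂)) (proj₂ (valid n))

Ω𝒵⇒HFit-suc : ∀ x → Ω𝒵 x → ∀ p q → HFit (x (p , q)) (x (ℤ.suc p , q))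
Ω𝒵⇒HFit-suc x valid p q = subst (λ n → HFit (x (p , q)) (x n)) (⊕-e₁ p q) (proj₁ (valid (p , q)))

Ω𝒵⇒VFit-suc : ∀ x → Ω𝒵 x → ∀ p q → VFit (x (p , q)) (x (p , ℤ.suc q))
Ω𝒵⇒VFit-suc x valid p q = subst (λ n → VFit (x (p , q)) (x n)) (⊕-e₂ p q) (proj₂ (valid (p , q)))

fits-suc⇒Ω𝒵 : ∀ x → (∀ p q → HFit (x (p , q)) (x (ℤ.suc p , q))) →
  (∀ p q → VFit (x (p , q)) (x (p , ℤ.suc q))) → Ω𝒵 x
fits-suc⇒Ω𝒵 x hfit vfit (p , q) =
  subst (λ n → HFit (x (p , q)) (x n)) (sym (⊕-e₁ p q)) (hfit p q) ,
  subst (λ n → VFit (x (p , q)) (x n)) (sym (⊕-e₂ p q)) (vfit p q)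

clamp : ∀ {n} → ℕ → Fin (suc n)
clamp zero = zero
clamp {zero} (suc i) = zero
clamp {suc n} (suc i) = suc (clamp i)

clamp-toℕ : ∀ {n} (i : Fin (suc n)) → clamp (toℕ i) ≡ i
clamp-toℕ zero = refl
clamp-toℕ {suc n} (suc i) = cong suc (clamp-toℕ i)

-- Coordinates beyond the block are clamped to its last column and row.
blockCell : ℋ → ℕ → ℕ → ℋ
blockCell t i j = cell (φ t) (clamp i) (clamp j)

cell≡blockCell : ∀ t i j → cell (φ t) i j ≡ blockCell t (toℕ i) (toℕ j)
cell≡blockCell t i j = sym (cong₂ (cell (φ t)) (clamp-toℕ i) (clamp-toℕ j))

∀-toℕ⇒∀-< : ∀ {n} {Pr : ℕ → Set} → (∀ (i : Fin n) → Pr (toℕ i)) → ∀ {i} → i < n → Pr i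
∀-toℕ⇒∀-< {Pr = Pr} h i<n = subst Pr (toℕ-fromℕ< i<n) (h (fromℕ< i<n))

HFit⇒same-height : ∀ t t' → HFit t t' → height (φ t) ≡ height (φ t')
HFit⇒same-height = from-yes (all? λ t → all? λ t' → HFit? t t' →-dec height (φ t) ℕ.≟ height (φ t'))

VFit⇒same-width : ∀ t t' → VFit t t' → width (φ t) ≡ width (φ t')
VFit⇒same-width = from-yes (all? λ t → all? λ t' → VFit? t t' →-dec width (φ t) ℕ.≟ width (φ t'))

blockCell-HFit : ∀ t i j → suc i < width (φ t) → j < height (φ t) →
  HFit (blockCell t i j) (blockCell t (suc i) j)
blockCell-HFit t i j i<w j<h = ∀-toℕ⇒∀-< (λ i → ∀-toℕ⇒∀-< (check t i) j<h) (ℕ.s<s⁻¹ i<w)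
  where
  check : ∀ t (i : Fin (w-1 (φ t))) (j : Fin (height (φ t))) →
    HFit (blockCell t (toℕ i) (toℕ j)) (blockCell t (suc (toℕ i)) (toℕ j))
  check = from-yes (all? λ t → all? λ (i : Fin (w-1 (φ t))) → all? λ (j : Fin (height (φ t))) →
    HFit? (blockCell t (toℕ i) (toℕ j)) (blockCell t (suc (toℕ i)) (toℕ j)))

blockCell-VFit : ∀ t i j → i < width (φ t) → suc j < height (φ t) →
  VFit (blockCell t i j) (blockCell t i (suc j))
blockCell-VFit t i j i<w j<h = ∀-toℕ⇒∀-< (λ i → ∀-toℕ⇒∀-< (check t i) (ℕ.s<s⁻¹ j<h)) i<w
  where
  check : ∀ t (i : Fin (width (φ t))) (j : Fin (h-1 (φ t))) →
    VFit (blockCell t (toℕ i) (toℕ j)) (blockCell t (toℕ i) (suc (toℕ j)))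
  check = from-yes (all? λ t → all? λ (i : Fin (width (φ t))) → all? λ (j : Fin (h-1 (φ t))) →
    VFit? (blockCell t (toℕ i) (toℕ j)) (blockCell t (toℕ i) (suc (toℕ j))))

EdgeH EdgeV : ℋ → ℋ → Set
EdgeH t t' = ∀ j → j < height (φ t) → HFit (blockCell t (w-1 (φ t)) j) (blockCell t' 0 j)
EdgeV t t' = ∀ i → i < width (φ t) → VFit (blockCell t i (h-1 (φ t))) (blockCell t' i 0)

edgeH? : ∀ t t' → Dec (∀ (j : Fin (height (φ t))) →
  HFit (blockCell t (w-1 (φ t)) (toℕ j)) (blockCell t' 0 (toℕ j)))
edgeH? t t' = all? λ j → HFit? (blockCell t (w-1 (φ t)) (toℕ j)) (blockCell t' 0 (toℕ j))

edgeV? : ∀ t t' → Dec (∀ (i : Fin (width (φ t))) →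
  VFit (blockCell t (toℕ i) (h-1 (φ t))) (blockCell t' (toℕ i) 0))
edgeV? t t' = all? λ i → VFit? (blockCell t (toℕ i) (h-1 (φ t))) (blockCell t' (toℕ i) 0)

HFit⇒EdgeH : ∀ t t' → HFit t t' → EdgeH t t'
HFit⇒EdgeH t t' fit j =
  ∀-toℕ⇒∀-< (from-yes (all? λ t → all? λ t' → HFit? t t' →-dec edgeH? t t') t t' fit)

VFit⇒EdgeV : ∀ t t' → VFit t t' → EdgeV t t'
VFit⇒EdgeV t t' fit i =
  ∀-toℕ⇒∀-< (from-yes (all? λ t → all? λ t' → VFit? t t' →-dec edgeV? t t') t t' fit)

EdgeH⇒HFit : ∀ t t' → height (φ t) ≡ height (φ t') → EdgeH t t' → HFit t t'
EdgeH⇒HFit t t' same edge =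
  from-yes (all? λ t → all? λ t' → height (φ t) ℕ.≟ height (φ t') →-dec edgeH? t t' →-dec HFit? t t')
    t t' same (λ j → edge (toℕ j) (toℕ<n j))

EdgeV⇒VFit : ∀ t t' → width (φ t) ≡ width (φ t') → EdgeV t t' → VFit t t'
EdgeV⇒VFit t t' same edge =
  from-yes (all? λ t → all? λ t' → width (φ t) ℕ.≟ width (φ t') →-dec edgeV? t t' →-dec VFit? t t')
    t t' same (λ i → edge (toℕ i) (toℕ<n i))

span : Bool → ℕ
span false = 1
span true = 2

span≤2 : ∀ b → span b ≤ 2
span≤2 false = s≤s z≤n
span≤2 true = ℕₚ.≤-refl

-- the letters occurring in the second column (row) of some block φ(s)
inSecondColumn inSecondRow : ℋ → Bool
inSecondColumn = lookup (true ∷ true ∷ false ∷ false ∷ false ∷ false ∷ false ∷ true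
                       ∷ true ∷ true ∷ true ∷ false ∷ false ∷ false ∷ false ∷ false ∷ [])
inSecondRow = lookup (true ∷ true ∷ true ∷ true ∷ true ∷ true ∷ true ∷ false
                    ∷ false ∷ false ∷ false ∷ false ∷ false ∷ false ∷ false ∷ false ∷ [])

inSecondColumn-VFit : ∀ a b → VFit a b → inSecondColumn a ≡ inSecondColumn b
inSecondColumn-VFit =
  from-yes (all? λ a → all? λ b → VFit? a b →-dec inSecondColumn a Boolₚ.≟ inSecondColumn b)

inSecondRow-HFit : ∀ a b → HFit a b → inSecondRow a ≡ inSecondRow b
inSecondRow-HFit = from-yes (all? λ a → all? λ b → HFit? a b →-dec inSecondRow a Boolₚ.≟ inSecondRow b)

corner-wide-and-tall : ∀ a → 1 ≤ w-1 (φ (blockCell a 0 0)) × 1 ≤ h-1 (φ (blockCell a 0 0))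
corner-wide-and-tall = from-yes (all? λ a →
  (1 ℕ.≤? w-1 (φ (blockCell a 0 0))) ×-dec (1 ℕ.≤? h-1 (φ (blockCell a 0 0))))

-- m columns, each listed from bottom to top
Patch : ℕ → ℕ → Set
Patch m n = Vec (Vec ℋ n) m

infix 5 _‼_‼_
_‼_‼_ : ∀ {m n} → Patch m n → Fin m → Fin n → ℋ
W ‼ i ‼ j = lookup (lookup W i) j

Stacked : ∀ {n} → Vec ℋ (suc n) → Set
Stacked (a ∷ []) = ⊤
Stacked (a ∷ b ∷ c) = VFit a b × Stacked (b ∷ c)

Valid : ∀ {m n} → Patch (suc m) (suc n) → Set
Valid (c ∷ []) = Stacked c
Valid (c ∷ d ∷ W) = Stacked c × Pointwise HFit c d × Valid (d ∷ W)

tiles : List ℋ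
tiles = allFin 16

-- The stacked columns whose j-th cell passes the j-th test; validPatches adds columns on the left, cell by
-- cell, each tested against its right neighbour, so that dead ends are cut off early.
stacks : ∀ {n} → Vec (ℋ → Bool) (suc n) → List (Vec ℋ (suc n))
stacks (p ∷ []) = map [_] (filterᵇ p tiles)
stacks (p ∷ ps@(_ ∷ _)) =
  concatMap (λ c → map (_∷ c) (filterᵇ (λ a → p a ∧ isYes (VFit? a (head c))) tiles)) (stacks ps)

validPatches : ∀ m n → List (Patch (suc m) (suc n))
validPatches zero n = map [_] (stacks (Vec.replicate _ (λ _ → true)))
validPatches (suc m) n =
  concatMap (λ W → map (_∷ W) (stacks (Vec.map (λ b a → isYes (HFit? a b)) (head W)))) (validPatches m n)

Passes : ∀ {n} → Vec (ℋ → Bool) n → Vec ℋ n → Set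
Passes = Pointwise (λ p a → T (p a))

passes-true : ∀ {n} (c : Vec ℋ n) → Passes (Vec.replicate n (λ _ → true)) c
passes-true [] = []
passes-true (a ∷ c) = tt ∷ passes-true c

passes-HFit : ∀ {n} {c d : Vec ℋ n} → Pointwise HFit c d → Passes (Vec.map (λ b a → isYes (HFit? a b)) d) c
passes-HFit [] = []
passes-HFit {c = a ∷ _} {b ∷ _} (ab ∷ fits) = fromWitness {a? = HFit? a b} ab ∷ passes-HFit fits

stacks-complete : ∀ {n} (ps : Vec (ℋ → Bool) (suc n)) (c : Vec ℋ (suc n)) →
  Stacked c → Passes ps c → c ∈ stacks ps
stacks-complete (p ∷ []) (a ∷ []) _ (pa ∷ []) = ∈-map⁺ [_] (∈-filter⁺ (λ a → T? (p a)) (∈-allFin a) pa)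
stacks-complete (p ∷ ps@(_ ∷ _)) (a ∷ c@(b ∷ _)) (ab , stacked) (pa ∷ passes) =
  ∈-concatMap⁺ _ (Any.map extend (stacks-complete ps c stacked passes))
  where
  extend : ∀ {d} → c ≡ d → a ∷ c ∈ map (_∷ d) (filterᵇ (λ a → p a ∧ isYes (VFit? a (head d))) tiles)
  extend refl = ∈-map⁺ (_∷ c) (∈-filter⁺ (λ a → T? (p a ∧ isYes (VFit? a b))) (∈-allFin a)
    (Boolₚ.T-∧ .Equivalence.from (pa , fromWitness {a? = VFit? a b} ab)))

validPatches-complete : ∀ {m n} (W : Patch (suc m) (suc n)) → Valid W → W ∈ validPatches m n
validPatches-complete (c ∷ []) stacked = ∈-map⁺ [_] (stacks-complete _ c stacked (passes-true c))
validPatches-complete (c ∷ W@(d ∷ _)) (stacked , fits , valid) =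
  ∈-concatMap⁺ _ (Any.map extend (validPatches-complete W valid))
  where
  extend : ∀ {V} → W ≡ V → c ∷ W ∈ map (_∷ V) (stacks (Vec.map (λ b a → isYes (HFit? a b)) (head V)))
  extend refl = ∈-map⁺ (_∷ W) (stacks-complete _ c stacked (passes-HFit fits))

∀-valid-patch : ∀ {m n} {Q : Patch (suc m) (suc n) → Set} (Q? : Decidable Q) →
  {True (All.all? Q? (validPatches m n))} → ∀ W → Valid W → Q W
∀-valid-patch Q? {holds} W valid = All.lookup (toWitness holds) (validPatches-complete W valid)

no-adjacent-second-columns : ∀ (W : Patch 3 3) → Valid W →
  inSecondColumn (W ‼ # 0 ‼ # 0) ≡ true → inSecondColumn (W ‼ # 1 ‼ # 0) ≡ false
no-adjacent-second-columns = ∀-valid-patch λ W →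
  (inSecondColumn (W ‼ # 0 ‼ # 0) Boolₚ.≟ true) →-dec (inSecondColumn (W ‼ # 1 ‼ # 0) Boolₚ.≟ false)

no-adjacent-second-rows : ∀ (W : Patch 5 3) → Valid W →
  inSecondRow (W ‼ # 0 ‼ # 0) ≡ true → inSecondRow (W ‼ # 0 ‼ # 1) ≡ false
no-adjacent-second-rows = ∀-valid-patch λ W →
  (inSecondRow (W ‼ # 0 ‼ # 0) Boolₚ.≟ true) →-dec (inSecondRow (W ‼ # 0 ‼ # 1) Boolₚ.≟ false)

Decodes : ℋ → Patch 3 3 → Set
Decodes t W =
  width (φ t) ≡ span (inSecondColumn (W ‼ # 1 ‼ # 0)) ×
  height (φ t) ≡ span (inSecondRow (W ‼ # 0 ‼ # 1)) ×
  (∀ (i j : Fin 2) → toℕ i < width (φ t) → toℕ j < height (φ t) →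
     W ‼ inject₁ i ‼ inject₁ j ≡ blockCell t (toℕ i) (toℕ j))

-- Opaque, so that the decoded letter is never computed by unfolding the exhaustive check.
opaque
  decodable : ∀ (W : Patch 3 3) → Valid W →
    inSecondColumn (W ‼ # 0 ‼ # 0) ≡ false → inSecondRow (W ‼ # 0 ‼ # 0) ≡ false → ∃ λ t → Decodes t W
  decodable = ∀-valid-patch λ W →
    (inSecondColumn (W ‼ # 0 ‼ # 0) Boolₚ.≟ false) →-dec (inSecondRow (W ‼ # 0 ‼ # 0) Boolₚ.≟ false) →-dec
    any? λ t →
      (width (φ t) ℕ.≟ span (inSecondColumn (W ‼ # 1 ‼ # 0))) ×-dec
      (height (φ t) ℕ.≟ span (inSecondRow (W ‼ # 0 ‼ # 1))) ×-dec
      all? λ i → all? λ j → (toℕ i ℕ.<? width (φ t)) →-dec (toℕ j ℕ.<? height (φ t)) →-dec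
        (W ‼ inject₁ i ‼ inject₁ j Fin.≟ blockCell t (toℕ i) (toℕ j))

column : Config → (n : ℕ) → Vec ℋ n
column x zero = []
column x (suc n) = x (+ 0 , + 0) ∷ column (σ e₂ x) n

window : Config → (m n : ℕ) → Patch m n
window x zero n = []
window x (suc m) n = column x n ∷ window (σ e₁ x) m n

lookup-column : ∀ x n (j : Fin n) → lookup (column x n) j ≡ x (+ 0 , + toℕ j)
lookup-column x (suc n) zero = refl
lookup-column x (suc n) (suc j) = trans (lookup-column (σ e₂ x) n j) (cong x (⊕-e₂ (+ 0) (+ toℕ j)))

window-lookup : ∀ x m n (i : Fin m) (j : Fin n) → window x m n ‼ i ‼ j ≡ x (+ toℕ i , + toℕ j)
window-lookup x (suc m) n zero j = lookup-column x n j
window-lookup x (suc m) n (suc i) j =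
  trans (window-lookup (σ e₁ x) m n i j) (cong x (⊕-e₁ (+ toℕ i) (+ toℕ j)))

column-stacked : ∀ x n → Ω𝒵 x → Stacked (column x (suc n))
column-stacked x zero valid = tt
column-stacked x (suc n) valid = proj₂ (valid (+ 0 , + 0)) , column-stacked (σ e₂ x) n (Ω𝒵-σ e₂ x valid)

column-HFit : ∀ x x' n → (∀ p → HFit (x p) (x' p)) → Pointwise HFit (column x n) (column x' n)
column-HFit x x' zero fits = []
column-HFit x x' (suc n) fits = fits _ ∷ column-HFit (σ e₂ x) (σ e₂ x') n (λ p → fits (p ⊕ e₂))

window-valid : ∀ x m n → Ω𝒵 x → Valid (window x (suc m) (suc n))
window-valid x zero n valid = column-stacked x n valid
window-valid x (suc m) n valid =
  column-stacked x n valid ,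
  column-HFit x (σ e₁ x) (suc n) (λ p → proj₁ (valid p)) ,
  window-valid (σ e₁ x) m n (Ω𝒵-σ e₁ x valid)

second-columns-isolated : ∀ x → Ω𝒵 x →
  inSecondColumn (x (+ 0 , + 0)) ≡ true → inSecondColumn (x (+ 1 , + 0)) ≡ false
second-columns-isolated x valid = no-adjacent-second-columns (window x 3 3) (window-valid x 2 2 valid)

second-rows-isolated : ∀ x → Ω𝒵 x →
  inSecondRow (x (+ 0 , + 0)) ≡ true → inSecondRow (x (+ 0 , + 1)) ≡ false
second-rows-isolated x valid = no-adjacent-second-rows (window x 5 3) (window-valid x 4 2 valid)

ShowsAtOrigin : Config → ℋ → Set
ShowsAtOrigin x t = ∀ i j → i < width (φ t) → j < height (φ t) → x (+ i , + j) ≡ blockCell t i j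

Decodes⇒ShowsAtOrigin : ∀ x t → Decodes t (window x 3 3) → ShowsAtOrigin x t
Decodes⇒ShowsAtOrigin x t (w≡ , h≡ , cells) i j i<w j<h =
  subst₂ (λ i j → x (+ i , + j) ≡ blockCell t i j) (toℕ-fromℕ< i<2) (toℕ-fromℕ< j<2)
    (at (fromℕ< i<2) (fromℕ< j<2)
      (subst (_< width (φ t)) (sym (toℕ-fromℕ< i<2)) i<w)
      (subst (_< height (φ t)) (sym (toℕ-fromℕ< j<2)) j<h))
  where
  below-2 : ∀ {k b m} → k < m → m ≡ span b → k < 2
  below-2 k<m refl = ℕₚ.<-≤-trans k<m (span≤2 _)
  i<2 = below-2 i<w w≡
  j<2 = below-2 j<h h≡
  at : ∀ (i j : Fin 2) → toℕ i < width (φ t) → toℕ j < height (φ t) →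
    x (+ toℕ i , + toℕ j) ≡ blockCell t (toℕ i) (toℕ j)
  at i j i<w j<h = begin
    x (+ toℕ i , + toℕ j)
      ≡⟨ cong₂ (λ a b → x (+ a , + b)) (toℕ-inject₁ i) (toℕ-inject₁ j) ⟨
    x (+ toℕ (inject₁ i) , + toℕ (inject₁ j))
      ≡⟨ window-lookup x 3 3 (inject₁ i) (inject₁ j) ⟨
    window x 3 3 ‼ inject₁ i ‼ inject₁ j
      ≡⟨ cells i j i<w j<h ⟩
    blockCell t (toℕ i) (toℕ j)
      ∎
    where open ≡-Reasoning

decode : ∀ x → Ω𝒵 x → inSecondColumn (x (+ 0 , + 0)) ≡ false → inSecondRow (x (+ 0 , + 0)) ≡ false →
  Σ ℋ λ t → width (φ t) ≡ span (inSecondColumn (x (+ 1 , + 0))) ×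
            height (φ t) ≡ span (inSecondRow (x (+ 0 , + 1))) × ShowsAtOrigin x t
decode x valid first-column first-row =
  t , proj₁ decodes , proj₁ (proj₂ decodes) , Decodes⇒ShowsAtOrigin x t decodes
  where
  found = decodable (window x 3 3) (window-valid x 2 2 valid) first-column first-row
  t = proj₁ found
  decodes = proj₂ found

ℤ-ind : ∀ {Pr : ℤ → Set} → Pr 0ℤ →
  (∀ r → Pr r → Pr (ℤ.suc r)) → (∀ r → Pr r → Pr (ℤ.pred r)) → ∀ r → Pr r
ℤ-ind base up down (+ zero) = base
ℤ-ind base up down (+ suc n) = up (+ n) (ℤ-ind base up down (+ n))
ℤ-ind base up down -[1+ zero ] = down 0ℤ base
ℤ-ind base up down -[1+ suc n ] = down -[1+ n ] (ℤ-ind base up down -[1+ n ])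

suc-invariant⇒constant : ∀ {A : Set} (f : ℤ → A) → (∀ r → f r ≡ f (ℤ.suc r)) → ∀ r → f r ≡ f 0ℤ
suc-invariant⇒constant f step = ℤ-ind refl
  (λ r eq → trans (sym (step r)) eq)
  (λ r eq → trans (step (ℤ.pred r)) (trans (cong f (ℤₚ.suc-pred r)) eq))

same-increments : ∀ (F G d : ℤ → ℤ) → (∀ n → F (ℤ.suc n) ≡ F n + d n) →
  (∀ n → G (ℤ.suc n) ≡ G n + d n) → F 0ℤ ≡ G 0ℤ → ∀ n → F n ≡ G n
same-increments F G d F-suc G-suc base = ℤ-ind base up down
  where
  up : ∀ r → F r ≡ G r → F (ℤ.suc r) ≡ G (ℤ.suc r)
  up r eq = trans (F-suc r) (trans (cong (_+ d r) eq) (sym (G-suc r)))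
  down : ∀ r → F r ≡ G r → F (ℤ.pred r) ≡ G (ℤ.pred r)
  down r eq = ∙-cancelʳ (d (ℤ.pred r)) _ _ (begin
    F (ℤ.pred r) + d (ℤ.pred r)  ≡⟨ F-suc (ℤ.pred r) ⟨
    F (ℤ.suc (ℤ.pred r))         ≡⟨ cong F (ℤₚ.suc-pred r) ⟩
    F r                          ≡⟨ eq ⟩
    G r                          ≡⟨ cong G (ℤₚ.suc-pred r) ⟨
    G (ℤ.suc (ℤ.pred r))         ≡⟨ G-suc (ℤ.pred r) ⟩
    G (ℤ.pred r) + d (ℤ.pred r)  ∎)
    where open ≡-Reasoning

suc-+-pos : ∀ a i → ℤ.suc (a + + i) ≡ a + + suc i
suc-+-pos a i = lemma a (+ i)
  where
  lemma : ∀ a i → 1ℤ + (a + i) ≡ a + (1ℤ + i)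
  lemma = solve-∀

pred-+-pos : ∀ a i → ℤ.pred (a + + suc i) ≡ a + + i
pred-+-pos a i = lemma a (+ i)
  where
  lemma : ∀ a i → -1ℤ + (a + (1ℤ + i)) ≡ a + i
  lemma = solve-∀

next-block-start : ∀ a {b} k → b ≡ a + + suc k → ℤ.suc (a + + k) ≡ b + + 0
next-block-start a {b} k eq = trans (suc-+-pos a k) (trans (sym eq) (sym (ℤₚ.+-identityʳ b)))

offset-suc : ∀ w n → offset w (ℤ.suc n) ≡ offset w n + + w n
offset-suc w (+ n) = refl
offset-suc w -[1+ zero ] = sym (ℤₚ.+-inverseˡ (+ w -[1+ 0 ]))
offset-suc w -[1+ suc n ] = sym (cancel (+ prefixSum (λ i → w -[1+ i ]) (suc n)) (+ w -[1+ suc n ]))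
  where
  cancel : ∀ a b → - (a + b) + b ≡ - a
  cancel = solve-∀

offset-unique : ∀ w (F : ℤ → ℤ) → (∀ n → F (ℤ.suc n) ≡ F n + + w n) → ∀ n → offset w n + F 0ℤ ≡ F n
offset-unique w F F-suc = same-increments (λ n → offset w n + F 0ℤ) F (λ n → + w n)
  (λ n → trans (cong (_+ F 0ℤ) (offset-suc w n)) (swap (offset w n) (+ w n) (F 0ℤ)))
  F-suc (ℤₚ.+-identityˡ (F 0ℤ))
  where
  swap : ∀ a b c → (a + b) + c ≡ (a + c) + b
  swap = solve-∀

Located : (ℤ → ℕ) → ℤ → Set
Located w r = ∃ λ n → ∃ λ i → i < w n × r ≡ offset w n + + i

located : ∀ w → (∀ n → 0 < w n) → ∀ r → Located w r
located w positive = ℤ-ind (0ℤ , 0 , positive 0ℤ , refl) up down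
  where
  up : ∀ r → Located w r → Located w (ℤ.suc r)
  up r (n , i , i<w , refl) with suc i ℕ.≟ w n
  ... | no i+1≢w = n , suc i , ℕₚ.≤∧≢⇒< i<w i+1≢w , suc-+-pos (offset w n) i
  ... | yes i+1≡w = ℤ.suc n , 0 , positive (ℤ.suc n) ,
    next-block-start (offset w n) i (trans (offset-suc w n) (cong (λ k → offset w n + + k) (sym i+1≡w)))
  down : ∀ r → Located w r → Located w (ℤ.pred r)
  down r (n , suc i , i<w , refl) = n , i , ℕₚ.<-trans (ℕₚ.n<1+n i) i<w , pred-+-pos (offset w n) i
  down r (n , zero , _ , refl) with w (ℤ.pred n) in eq | positive (ℤ.pred n)
  ... | suc k | _ = ℤ.pred n , k , subst (k <_) (sym eq) (ℕₚ.n<1+n k) , (begin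
    ℤ.pred (offset w n + + 0)                      ≡⟨ cong ℤ.pred (ℤₚ.+-identityʳ (offset w n)) ⟩
    ℤ.pred (offset w n)                            ≡⟨ cong (λ m → ℤ.pred (offset w m)) (ℤₚ.suc-pred n) ⟨
    ℤ.pred (offset w (ℤ.suc (ℤ.pred n)))           ≡⟨ cong ℤ.pred (offset-suc w (ℤ.pred n)) ⟩
    ℤ.pred (offset w (ℤ.pred n) + + w (ℤ.pred n))  ≡⟨ cong (λ m → ℤ.pred (offset w (ℤ.pred n) + + m)) eq ⟩
    ℤ.pred (offset w (ℤ.pred n) + + suc k)         ≡⟨ pred-+-pos (offset w (ℤ.pred n)) k ⟩
    offset w (ℤ.pred n) + + k                      ∎)
    where open ≡-Reasoning

-- Enumerates in increasing order the p with second p ≡ false: the first points of the blocks into which ℤ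
-- is cut when each p with second p ≡ true is glued to its predecessor.
module BlockStarts (second : ℤ → Bool) (isolated : ∀ p → second p ≡ true → second (ℤ.suc p) ≡ false) where

  next prev : ℤ → ℤ
  next p = p + + span (second (ℤ.suc p))
  prev p = p - + span (second (ℤ.pred p))

  isolated⁻ : ∀ p → second (ℤ.suc p) ≡ true → second p ≡ false
  isolated⁻ p eq with second p in eq′
  ... | false = refl
  ... | true = trans (sym eq) (isolated p eq′)

  next-single : ∀ p → second (ℤ.suc p) ≡ false → next p ≡ ℤ.suc p
  next-single p eq = trans (cong (λ b → p + + span b) eq) (ℤₚ.+-comm p 1ℤ)

  next-double : ∀ p → second (ℤ.suc p) ≡ true → next p ≡ ℤ.suc (ℤ.suc p)
  next-double p eq = trans (cong (λ b → p + + span b) eq) (+2≡suc-suc p)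
    where
    +2≡suc-suc : ∀ p → p + (1ℤ + 1ℤ) ≡ 1ℤ + (1ℤ + p)
    +2≡suc-suc = solve-∀

  prev-single : ∀ p → second (ℤ.pred p) ≡ false → prev p ≡ ℤ.pred p
  prev-single p eq = trans (cong (λ b → p - + span b) eq) (ℤₚ.+-comm p -1ℤ)

  prev-double : ∀ p → second (ℤ.pred p) ≡ true → prev p ≡ ℤ.pred (ℤ.pred p)
  prev-double p eq = trans (cong (λ b → p - + span b) eq) (-2≡pred-pred p)
    where
    -2≡pred-pred : ∀ p → p - (1ℤ + 1ℤ) ≡ -1ℤ + (-1ℤ + p)
    -2≡pred-pred = solve-∀

  next-start : ∀ p → second (next p) ≡ false
  next-start p = cases (second (ℤ.suc p)) refl
    where
    cases : ∀ b → second (ℤ.suc p) ≡ b → second (next p) ≡ false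
    cases false eq = trans (cong second (next-single p eq)) eq
    cases true eq = trans (cong second (next-double p eq)) (isolated (ℤ.suc p) eq)

  prev-start : ∀ p → second (prev p) ≡ false
  prev-start p = cases (second (ℤ.pred p)) refl
    where
    cases : ∀ b → second (ℤ.pred p) ≡ b → second (prev p) ≡ false
    cases false eq = trans (cong second (prev-single p eq)) eq
    cases true eq = trans (cong second (prev-double p eq))
      (isolated⁻ (ℤ.pred (ℤ.pred p)) (trans (cong second (ℤₚ.suc-pred (ℤ.pred p))) eq))

  next-prev : ∀ p → second p ≡ false → next (prev p) ≡ p
  next-prev p start = cases (second (ℤ.pred p)) refl
    where
    open ≡-Reasoning
    p-2 = ℤ.pred (ℤ.pred p)
    cases : ∀ b → second (ℤ.pred p) ≡ b → next (prev p) ≡ p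
    cases false eq = begin
      next (prev p)     ≡⟨ cong next (prev-single p eq) ⟩
      next (ℤ.pred p)   ≡⟨ next-single (ℤ.pred p) (trans (cong second (ℤₚ.suc-pred p)) start) ⟩
      ℤ.suc (ℤ.pred p)  ≡⟨ ℤₚ.suc-pred p ⟩
      p                 ∎
    cases true eq = begin
      next (prev p)          ≡⟨ cong next (prev-double p eq) ⟩
      next p-2               ≡⟨ next-double p-2 (trans (cong second (ℤₚ.suc-pred (ℤ.pred p))) eq) ⟩
      ℤ.suc (ℤ.suc p-2)      ≡⟨ cong ℤ.suc (ℤₚ.suc-pred (ℤ.pred p)) ⟩
      ℤ.suc (ℤ.pred p)       ≡⟨ ℤₚ.suc-pred p ⟩
      p                      ∎

  origin : ℤ
  origin = if second 0ℤ then 1ℤ else 0ℤ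

  origin-start : second origin ≡ false
  origin-start with second 0ℤ in eq
  ... | false = eq
  ... | true = isolated 0ℤ eq

  upward downward : ℕ → ℤ
  upward zero = origin
  upward (suc n) = next (upward n)
  downward zero = prev origin
  downward (suc n) = prev (downward n)

  blockStart : ℤ → ℤ
  blockStart (+ n) = upward n
  blockStart -[1+ n ] = downward n

  blockStart-start : ∀ n → second (blockStart n) ≡ false
  blockStart-start (+ zero) = origin-start
  blockStart-start (+ suc n) = next-start (upward n)
  blockStart-start -[1+ zero ] = prev-start origin
  blockStart-start -[1+ suc n ] = prev-start (downward n)

  blockStart-suc : ∀ n → blockStart (ℤ.suc n) ≡ next (blockStart n)
  blockStart-suc (+ n) = refl
  blockStart-suc -[1+ zero ] = sym (next-prev origin origin-start)
  blockStart-suc -[1+ suc n ] = sym (next-prev (downward n) (blockStart-start -[1+ n ]))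

module φ-Image (y : Config) (y-valid : Ω𝒵 y) (x : Config) (image : IsφImage y x) where

  X Y : ℤ → ℤ
  X = offset (colWidth y)
  Y = offset (rowHeight y)

  width≡colWidth : ∀ p q → width (φ (y (p , q))) ≡ colWidth y p
  width≡colWidth p = suc-invariant⇒constant (λ q → width (φ (y (p , q))))
    (λ q → VFit⇒same-width (y (p , q)) (y (p , ℤ.suc q)) (Ω𝒵⇒VFit-suc y y-valid p q))

  height≡rowHeight : ∀ p q → height (φ (y (p , q))) ≡ rowHeight y q
  height≡rowHeight p q = suc-invariant⇒constant (λ p → height (φ (y (p , q))))
    (λ p → HFit⇒same-height (y (p , q)) (y (ℤ.suc p , q)) (Ω𝒵⇒HFit-suc y y-valid p q)) p

  image-cell : ∀ p q i j → i < colWidth y p → j < rowHeight y q →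
    x (X p + + i , Y q + + j) ≡ blockCell (y (p , q)) i j
  image-cell p q i j i<w j<h =
    subst₂ (λ i j → x (X p + + i , Y q + + j) ≡ blockCell t i j) (toℕ-fromℕ< i<w′) (toℕ-fromℕ< j<h′)
      (trans (image (p , q) (fromℕ< i<w′) (fromℕ< j<h′)) (cell≡blockCell t _ _))
    where
    t = y (p , q)
    i<w′ = subst (i <_) (sym (width≡colWidth p q)) i<w
    j<h′ = subst (j <_) (sym (height≡rowHeight p q)) j<h

  image-HFit : ∀ p q i j → i < colWidth y p → j < rowHeight y q →
    HFit (x (X p + + i , Y q + + j)) (x (ℤ.suc (X p + + i) , Y q + + j))
  image-HFit p q i j i<w j<h with suc i ℕ.<? colWidth y p
  ... | yes i+1<w =
    subst₂ HFit (sym (image-cell p q i j i<w j<h))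
      (sym (trans (cong (λ r → x (r , Y q + + j)) (suc-+-pos (X p) i)) (image-cell p q (suc i) j i+1<w j<h)))
      (blockCell-HFit t i j (subst (suc i <_) (sym (width≡colWidth p q)) i+1<w) j<h′)
    where
    t = y (p , q)
    j<h′ = subst (j <_) (sym (height≡rowHeight p q)) j<h
  ... | no i+1≮w =
    subst₂ HFit (trans (cong (λ k → blockCell t k j) i-last) (sym (image-cell p q i j i<w j<h)))
      (sym (trans (cong (λ r → x (r , Y q + + j)) (next-block-start (X p) i X-step))
                  (image-cell (ℤ.suc p) q 0 j z<s j<h)))
      (HFit⇒EdgeH t (y (ℤ.suc p , q)) (Ω𝒵⇒HFit-suc y y-valid p q) j j<h′)
    where
    t = y (p , q)
    j<h′ = subst (j <_) (sym (height≡rowHeight p q)) j<h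
    last : suc i ≡ colWidth y p
    last = ℕₚ.≤∧≮⇒≡ i<w i+1≮w
    i-last : w-1 (φ t) ≡ i
    i-last = ℕₚ.suc-injective (trans (width≡colWidth p q) (sym last))
    X-step : X (ℤ.suc p) ≡ X p + + suc i
    X-step = trans (offset-suc (colWidth y) p) (cong (λ k → X p + + k) (sym last))

  image-VFit : ∀ p q i j → i < colWidth y p → j < rowHeight y q →
    VFit (x (X p + + i , Y q + + j)) (x (X p + + i , ℤ.suc (Y q + + j)))
  image-VFit p q i j i<w j<h with suc j ℕ.<? rowHeight y q
  ... | yes j+1<h =
    subst₂ VFit (sym (image-cell p q i j i<w j<h))
      (sym (trans (cong (λ r → x (X p + + i , r)) (suc-+-pos (Y q) j)) (image-cell p q i (suc j) i<w j+1<h)))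
      (blockCell-VFit t i j i<w′ (subst (suc j <_) (sym (height≡rowHeight p q)) j+1<h))
    where
    t = y (p , q)
    i<w′ = subst (i <_) (sym (width≡colWidth p q)) i<w
  ... | no j+1≮h =
    subst₂ VFit (trans (cong (blockCell t i) j-last) (sym (image-cell p q i j i<w j<h)))
      (sym (trans (cong (λ r → x (X p + + i , r)) (next-block-start (Y q) j Y-step))
                  (image-cell p (ℤ.suc q) i 0 i<w z<s)))
      (VFit⇒EdgeV t (y (p , ℤ.suc q)) (Ω𝒵⇒VFit-suc y y-valid p q) i i<w′)
    where
    t = y (p , q)
    i<w′ = subst (i <_) (sym (width≡colWidth p q)) i<w
    last : suc j ≡ rowHeight y q
    last = ℕₚ.≤∧≮⇒≡ j<h j+1≮h
    j-last : h-1 (φ t) ≡ j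
    j-last = ℕₚ.suc-injective (trans (height≡rowHeight p q) (sym last))
    Y-step : Y (ℤ.suc q) ≡ Y q + + suc j
    Y-step = trans (offset-suc (rowHeight y) q) (cong (λ k → Y q + + k) (sym last))

  image-valid : Ω𝒵 x
  image-valid = fits-suc⇒Ω𝒵 x hfit vfit
    where
    hfit : ∀ r₁ r₂ → HFit (x (r₁ , r₂)) (x (ℤ.suc r₁ , r₂))
    hfit r₁ r₂ with located (colWidth y) (λ _ → z<s) r₁ | located (rowHeight y) (λ _ → z<s) r₂
    ... | p , i , i<w , refl | q , j , j<h , refl = image-HFit p q i j i<w j<h
    vfit : ∀ r₁ r₂ → VFit (x (r₁ , r₂)) (x (r₁ , ℤ.suc r₂))
    vfit r₁ r₂ with located (colWidth y) (λ _ → z<s) r₁ | located (rowHeight y) (λ _ → z<s) r₂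
    ... | p , i , i<w , refl | q , j , j<h , refl = image-VFit p q i j i<w j<h

shift-closure⊆Ω𝒵 : ∀ x → InShiftClosureφΩ x → Ω𝒵 x
shift-closure⊆Ω𝒵 x (k , y , y-valid , image) =
  Ω𝒵-resp (σ k (σ (neg k) x)) x (λ n → cong x (⊕-neg-cancel n k))
    (Ω𝒵-σ k (σ (neg k) x) (φ-Image.image-valid y y-valid (σ (neg k) x) image))

module Desubstitution (x : Config) (x-valid : Ω𝒵 x) where

  secondColumn secondRow : ℤ → Bool
  secondColumn p = inSecondColumn (x (p , 0ℤ))
  secondRow q = inSecondRow (x (0ℤ , q))

  secondColumn-along : ∀ p q → inSecondColumn (x (p , q)) ≡ secondColumn p
  secondColumn-along p = suc-invariant⇒constant (λ q → inSecondColumn (x (p , q)))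
    (λ q → inSecondColumn-VFit (x (p , q)) (x (p , ℤ.suc q)) (Ω𝒵⇒VFit-suc x x-valid p q))

  secondRow-along : ∀ p q → inSecondRow (x (p , q)) ≡ secondRow q
  secondRow-along p q = suc-invariant⇒constant (λ p → inSecondRow (x (p , q)))
    (λ p → inSecondRow-HFit (x (p , q)) (x (ℤ.suc p , q)) (Ω𝒵⇒HFit-suc x x-valid p q)) p

  secondColumn-isolated : ∀ p → secondColumn p ≡ true → secondColumn (ℤ.suc p) ≡ false
  secondColumn-isolated p second = second-columns-isolated (σ (p , 0ℤ) x) (Ω𝒵-σ (p , 0ℤ) x x-valid)
    (trans (cong (λ r → inSecondColumn (x (r , 0ℤ))) (ℤₚ.+-identityˡ p)) second)

  secondRow-isolated : ∀ q → secondRow q ≡ true → secondRow (ℤ.suc q) ≡ false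
  secondRow-isolated q second = second-rows-isolated (σ (0ℤ , q) x) (Ω𝒵-σ (0ℤ , q) x x-valid)
    (trans (cong (λ r → inSecondRow (x (0ℤ , r))) (ℤₚ.+-identityˡ q)) second)

  module Columns = BlockStarts secondColumn secondColumn-isolated
  module Rows = BlockStarts secondRow secondRow-isolated
  open Columns using () renaming (blockStart to X)
  open Rows using () renaming (blockStart to Y)

  x[_,_] : ℤ → ℤ → Config
  x[ p , q ] = σ (X p , Y q) x

  corner : ∀ p q → x[ p , q ] (+ 0 , + 0) ≡ x (X p , Y q)
  corner p q = cong x (cong₂ _,_ (ℤₚ.+-identityˡ (X p)) (ℤₚ.+-identityˡ (Y q)))

  corner-first-column : ∀ p q → inSecondColumn (x[ p , q ] (+ 0 , + 0)) ≡ false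
  corner-first-column p q =
    trans (cong inSecondColumn (corner p q)) (trans (secondColumn-along (X p) (Y q)) (Columns.blockStart-start p))

  corner-first-row : ∀ p q → inSecondRow (x[ p , q ] (+ 0 , + 0)) ≡ false
  corner-first-row p q =
    trans (cong inSecondRow (corner p q)) (trans (secondRow-along (X p) (Y q)) (Rows.blockStart-start q))

  decoded : ∀ p q → Σ ℋ λ t → width (φ t) ≡ span (inSecondColumn (x[ p , q ] (+ 1 , + 0))) ×
    height (φ t) ≡ span (inSecondRow (x[ p , q ] (+ 0 , + 1))) × ShowsAtOrigin x[ p , q ] t
  decoded p q = decode x[ p , q ] (Ω𝒵-σ (X p , Y q) x x-valid) (corner-first-column p q) (corner-first-row p q)

  y : Config
  y (p , q) = proj₁ (decoded p q)

  y-width : ∀ p q → width (φ (y (p , q))) ≡ span (secondColumn (ℤ.suc (X p)))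
  y-width p q = trans (proj₁ (proj₂ (decoded p q))) (cong span (secondColumn-along _ _))

  y-height : ∀ p q → height (φ (y (p , q))) ≡ span (secondRow (ℤ.suc (Y q)))
  y-height p q = trans (proj₁ (proj₂ (proj₂ (decoded p q)))) (cong span (secondRow-along _ _))

  y-cell : ∀ p q i j → i < width (φ (y (p , q))) → j < height (φ (y (p , q))) →
    x (X p + + i , Y q + + j) ≡ blockCell (y (p , q)) i j
  y-cell p q i j i<w j<h = trans (cong x (cong₂ _,_ (ℤₚ.+-comm (X p) (+ i)) (ℤₚ.+-comm (Y q) (+ j))))
    (proj₂ (proj₂ (proj₂ (decoded p q))) i j i<w j<h)

  X-step : ∀ p q → X (ℤ.suc p) ≡ X p + + width (φ (y (p , q)))
  X-step p q = trans (Columns.blockStart-suc p) (cong (λ w → X p + + w) (sym (y-width p q)))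

  Y-step : ∀ p q → Y (ℤ.suc q) ≡ Y q + + height (φ (y (p , q)))
  Y-step p q = trans (Rows.blockStart-suc q) (cong (λ h → Y q + + h) (sym (y-height p q)))

  y-HFit : ∀ p q → HFit (y (p , q)) (y (ℤ.suc p , q))
  y-HFit p q = EdgeH⇒HFit t t' same-height edge
    where
    t = y (p , q)
    t' = y (ℤ.suc p , q)
    same-height = trans (y-height p q) (sym (y-height (ℤ.suc p) q))
    edge : EdgeH t t'
    edge j j<h = subst₂ HFit (y-cell p q (w-1 (φ t)) j (ℕₚ.n<1+n _) j<h)
      (trans (cong (λ a → x (a , Y q + + j)) (next-block-start (X p) (w-1 (φ t)) (X-step p q)))
             (y-cell (ℤ.suc p) q 0 j z<s (subst (j <_) same-height j<h)))
      (Ω𝒵⇒HFit-suc x x-valid (X p + + w-1 (φ t)) (Y q + + j))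

  y-VFit : ∀ p q → VFit (y (p , q)) (y (p , ℤ.suc q))
  y-VFit p q = EdgeV⇒VFit t t' same-width edge
    where
    t = y (p , q)
    t' = y (p , ℤ.suc q)
    same-width = trans (y-width p q) (sym (y-width p (ℤ.suc q)))
    edge : EdgeV t t'
    edge i i<w = subst₂ VFit (y-cell p q i (h-1 (φ t)) i<w (ℕₚ.n<1+n _))
      (trans (cong (λ b → x (X p + + i , b)) (next-block-start (Y q) (h-1 (φ t)) (Y-step p q)))
             (y-cell p (ℤ.suc q) i 0 (subst (i <_) same-width i<w) z<s))
      (Ω𝒵⇒VFit-suc x x-valid (X p + + i) (Y q + + h-1 (φ t)))

  y-valid : Ω𝒵 y
  y-valid = fits-suc⇒Ω𝒵 y y-HFit y-VFit

  origin : Pos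
  origin = X 0ℤ , Y 0ℤ

  -- The shift witnessing membership of x in the closure is neg origin: φ(y) is x translated so that
  -- block (0 , 0) starts at the origin.
  image : IsφImage y (σ (neg (neg origin)) x)
  image (p , q) i j = begin
    x ((offset (colWidth y) p + + toℕ i , offset (rowHeight y) q + + toℕ j) ⊕ neg (neg origin))
      ≡⟨ cong x (cong₂ _,_ (shifted (colWidth y) X (λ p → X-step p 0ℤ) p (toℕ i))
                           (shifted (rowHeight y) Y (Y-step 0ℤ) q (toℕ j))) ⟩
    x (X p + + toℕ i , Y q + + toℕ j)      ≡⟨ y-cell p q (toℕ i) (toℕ j) (toℕ<n i) (toℕ<n j) ⟩
    blockCell (y (p , q)) (toℕ i) (toℕ j)  ≡⟨ cell≡blockCell (y (p , q)) i j ⟨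
    cell (φ (y (p , q))) i j               ∎
    where
    open ≡-Reasoning
    shifted : ∀ w (F : ℤ → ℤ) → (∀ n → F (ℤ.suc n) ≡ F n + + w n) → ∀ n i →
      (offset w n + + i) + - (- F 0ℤ) ≡ F n + + i
    shifted w F F-suc n i = begin
      (offset w n + + i) + - (- F 0ℤ)  ≡⟨ cong (λ c → (offset w n + + i) + c) (ℤₚ.neg-involutive (F 0ℤ)) ⟩
      (offset w n + + i) + F 0ℤ        ≡⟨ swap (offset w n) (+ i) (F 0ℤ) ⟩
      (offset w n + F 0ℤ) + + i        ≡⟨ cong (_+ + i) (offset-unique w F F-suc n) ⟩
      F n + + i                        ∎
      where
      swap : ∀ a b c → (a + b) + c ≡ (a + c) + b
      swap = solve-∀

Ω𝒵⊆shift-closure : ∀ x → Ω𝒵 x → InShiftClosureφΩ x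
Ω𝒵⊆shift-closure x valid = neg origin , y , y-valid , image
  where open Desubstitution x valid

module Growth {A : Set} (I : ℕ → A → ℕ) (positive : ∀ k a → 1 ≤ I k a)
  (doubling : ∀ m k → (∀ b → m ≤ I k b) → ∀ a → m ℕ.+ m ≤ I (suc (suc k)) a) where

  linear : ∀ n j a → suc n ≤ I (n ℕ.* 2 ℕ.+ j) a
  linear zero j a = positive j a
  linear (suc n) j a =
    ℕₚ.≤-trans (s≤s (ℕₚ.m≤n+m (suc n) n)) (doubling (suc n) (n ℕ.* 2 ℕ.+ j) (linear n j) a)

  unbounded : ∀ n a k → n ℕ.* 2 ≤ k → n ≤ I k a
  unbounded n a k le =
    subst (λ k → n ≤ I k a) (ℕₚ.m+[n∸m]≡n le) (ℕₚ.≤-trans (ℕₚ.n≤1+n n) (linear n (k ∸ n ℕ.* 2) a))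

sum-head : ∀ {n} (g : Fin (suc n) → ℕ) → g zero ≤ sum (map g (allFin (suc n)))
sum-head g = ℕₚ.m≤m+n (g zero) _

sum-first-two : ∀ {n} (g : Fin (suc n) → ℕ) → 1 ≤ n → g zero ℕ.+ g (clamp 1) ≤ sum (map g (allFin (suc n)))
sum-first-two {suc n} g _ = ℕₚ.+-monoʳ-≤ (g zero) (ℕₚ.m≤m+n (g (suc zero)) _)

iterWidth-positive : ∀ k a → 1 ≤ iterWidth k a
iterWidth-positive zero a = ℕₚ.≤-refl
iterWidth-positive (suc k) a =
  ℕₚ.≤-trans (iterWidth-positive k (blockCell a 0 0)) (sum-head (λ i → iterWidth k (cell (φ a) i zero)))

iterHeight-positive : ∀ k a → 1 ≤ iterHeight k a
iterHeight-positive zero a = ℕₚ.≤-refl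
iterHeight-positive (suc k) a =
  ℕₚ.≤-trans (iterHeight-positive k (blockCell a 0 0)) (sum-head (λ j → iterHeight k (cell (φ a) zero j)))

iterWidth-doubling : ∀ m k → (∀ b → m ≤ iterWidth k b) → ∀ a → m ℕ.+ m ≤ iterWidth (suc (suc k)) a
iterWidth-doubling m k bound a = ℕₚ.≤-trans (ℕₚ.≤-trans (ℕₚ.+-mono-≤ (bound _) (bound _))
    (sum-first-two (λ i → iterWidth k (cell (φ c) i zero)) (proj₁ (corner-wide-and-tall a))))
  (sum-head (λ i → iterWidth (suc k) (cell (φ a) i zero)))
  where c = blockCell a 0 0

iterHeight-doubling : ∀ m k → (∀ b → m ≤ iterHeight k b) → ∀ a → m ℕ.+ m ≤ iterHeight (suc (suc k)) a
iterHeight-doubling m k bound a = ℕₚ.≤-trans (ℕₚ.≤-trans (ℕₚ.+-mono-≤ (bound _) (bound _))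
    (sum-first-two (λ j → iterHeight k (cell (φ c) zero j)) (proj₂ (corner-wide-and-tall a))))
  (sum-head (λ j → iterHeight (suc k) (cell (φ a) zero j)))
  where c = blockCell a 0 0

expansive : Expansive
expansive a n = n ℕ.* 2 , λ k le → Width.unbounded n a k le , Height.unbounded n a k le
  where
  module Width = Growth iterWidth iterWidth-positive iterWidth-doubling
  module Height = Growth iterHeight iterHeight-positive iterHeight-doubling

proposition4 : Expansive × (∀ (x : Config) → Ω𝒵 x ⇔ InShiftClosureφΩ x)
proposition4 = expansive , λ x → mk⇔ (Ω𝒵⊆shift-closure x) (shift-closure⊆Ω𝒵 x)
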